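{- Let $b\ge a\ge 2$ be integers and $n\ge a+3$. Then the graph $H_{n,a}=K_{a-1}\nabla(K_1\cup K_{n-a})$ is not a fractional $[a,b]$-covered graph.
   Context: All graphs are finite, simple and undirected. For graphs $G_1,G_2$, the join $G_1\nabla G_2$ is obtained from the disjoint union $G_1\cup G_2$ by adding all edges between $G_1$ and $G_2$. For positive integers $a\le b$, a fractional $[a,b]$-factor of $G$ with indicator function $h$ is given by a function $h:E(G)\to[0,1]$ with $a\le \sum_{e\in E_G(x)} h(e)\le b$ for every vertex $x$, where $E_G(x)$ is the set of edges incident with $x$. $G$ is fractional $[a,b]$-covered if for every edge $e$ of $G$ there is a fractional $[a,b]$-factor with indicator function $h$ such that $h(e)=1$.
   Formalization: The indicator function h of each fractional [a,b]-factor takes rational values in $[0,1]$. -}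

module Defs where

open import Data.Nat using (ℕ; zero; suc; _+_; _∸_)
open import Data.Fin using (Fin; zero; suc; splitAt)
import Data.Fin as F
open import Data.Bool using (Bool; true; false; not)
open import Data.Sum using (_⊎_; inj₁; inj₂)
open import Data.Product using (_×_; _,_; Σ)
open import Data.Integer using (+_)
open import Data.Rational using (ℚ; 0ℚ; 1ℚ; _≤_; _/_) renaming (_+_ to _+ℚ_)
open import Relation.Nullary using (yes; no)
open import Relation.Binary.PropositionalEquality using (_≡_; refl; sym)

record Graph : Set where
  field
    n      : ℕ
    adj    : Fin n → Fin n → Bool
    adj-sym : ∀ x y → adj x y ≡ adj y x
    adj-irr : ∀ x → adj x x ≡ false
open Graph public

neqB : ∀ {m} → Fin m → Fin m → Bool
neqB x y with x F.≟ y
... | yes _ = false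
... | no _ = true

neqB-sym : ∀ {m} (x y : Fin m) → neqB x y ≡ neqB y x
neqB-sym x y with x F.≟ y | y F.≟ x
... | yes _ | yes _ = refl
... | no _ | no _ = refl
... | yes p | no q with q (sym p)
...   | ()
neqB-sym x y | no p | yes q with p (sym q)
...   | ()

neqB-irr : ∀ {m} (x : Fin m) → neqB x x ≡ false
neqB-irr x with x F.≟ x
... | yes _ = refl
... | no p with p refl
...   | ()

K : ℕ → Graph
K m = record { n = m ; adj = neqB ; adj-sym = neqB-sym ; adj-irr = neqB-irr }

-- adjacency on a disjoint sum of vertex sets; `cross` is the value for
-- pairs lying in different parts (false = union, true = join)
sumAdj : ∀ {m k} → Bool → (Fin m → Fin m → Bool) → (Fin k → Fin k → Bool)
       → Fin (m + k) → Fin (m + k) → Bool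
sumAdj {m} c A B x y with splitAt m x | splitAt m y
... | inj₁ x' | inj₁ y' = A x' y'
... | inj₂ x' | inj₂ y' = B x' y'
... | inj₁ _  | inj₂ _  = c
... | inj₂ _  | inj₁ _  = c

sumAdj-sym : ∀ {m k} c (A : Fin m → Fin m → Bool) (B : Fin k → Fin k → Bool)
  → (∀ x y → A x y ≡ A y x) → (∀ x y → B x y ≡ B y x)
  → ∀ x y → sumAdj c A B x y ≡ sumAdj c A B y x
sumAdj-sym {m} c A B sA sB x y with splitAt m x | splitAt m y
... | inj₁ x' | inj₁ y' = sA x' y'
... | inj₂ x' | inj₂ y' = sB x' y'
... | inj₁ _  | inj₂ _  = refl
... | inj₂ _  | inj₁ _  = refl

sumAdj-irr : ∀ {m k} c (A : Fin m → Fin m → Bool) (B : Fin k → Fin k → Bool)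
  → (∀ x → A x x ≡ false) → (∀ x → B x x ≡ false)
  → ∀ x → sumAdj c A B x x ≡ false
sumAdj-irr {m} c A B iA iB x with splitAt m x
... | inj₁ x' = iA x'
... | inj₂ x' = iB x'

_∪ᴳ_ : Graph → Graph → Graph
G₁ ∪ᴳ G₂ = record
  { n = n G₁ + n G₂
  ; adj = sumAdj false (adj G₁) (adj G₂)
  ; adj-sym = sumAdj-sym false (adj G₁) (adj G₂) (adj-sym G₁) (adj-sym G₂)
  ; adj-irr = sumAdj-irr false (adj G₁) (adj G₂) (adj-irr G₁) (adj-irr G₂) }

_∇_ : Graph → Graph → Graph
G₁ ∇ G₂ = record
  { n = n G₁ + n G₂
  ; adj = sumAdj true (adj G₁) (adj G₂)
  ; adj-sym = sumAdj-sym true (adj G₁) (adj G₂) (adj-sym G₁) (adj-sym G₂)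
  ; adj-irr = sumAdj-irr true (adj G₁) (adj G₂) (adj-irr G₁) (adj-irr G₂) }

Σℚ : ∀ n → (Fin n → ℚ) → ℚ
Σℚ zero f = 0ℚ
Σℚ (suc n) f = f zero +ℚ Σℚ n (λ i → f (suc i))

ℕtoℚ : ℕ → ℚ
ℕtoℚ k = + k / 1

-- An indicator function is given by a symmetric h : V → V → ℚ, where
-- h x y is the value on the edge xy (values on non-edges are ignored).
-- Sum of h over the edges incident with x:
edgeSum : (G : Graph) → (Fin (n G) → Fin (n G) → ℚ) → Fin (n G) → ℚ
edgeSum G h x = Σℚ (n G) (λ y → ifAdj (adj G x y) (h x y))
  where
  ifAdj : Bool → ℚ → ℚ
  ifAdj true q = q
  ifAdj false _ = 0ℚ

IsFracFactor : (G : Graph) → ℕ → ℕ → (Fin (n G) → Fin (n G) → ℚ) → Set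
IsFracFactor G a b h =
  (∀ x y → h x y ≡ h y x) ×
  (∀ x y → adj G x y ≡ true → (0ℚ ≤ h x y) × (h x y ≤ 1ℚ)) ×
  (∀ x → (ℕtoℚ a ≤ edgeSum G h x) × (edgeSum G h x ≤ ℕtoℚ b))

FracCovered : Graph → ℕ → ℕ → Set
FracCovered G a b =
  ∀ x y → adj G x y ≡ true →
  Σ (Fin (n G) → Fin (n G) → ℚ) (λ h → IsFracFactor G a b h × (h x y ≡ 1ℚ))

H : ℕ → ℕ → Graph
H n a = K (a ∸ 1) ∇ (K 1 ∪ᴳ K (n ∸ a))

{-# OPTIONS --safe #-}
module Submission where

-- The vertex of K₁ is adjacent only to the a − 1 vertices of K_{a−1}. An
-- indicator function is at most 1 on every edge, so the weight around that
-- vertex is at most a − 1 < a: H_{n,a} has no fractional [a,b]-factor at all,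
-- let alone one through a prescribed edge.

open import Defs
open import Data.Nat using (ℕ; zero; suc; _+_; _∸_; _≤_; s≤s)
open import Data.Nat.Properties using (1+n≰n; +-identityʳ)
open import Data.Nat.Coprimality using (Coprime; 1-coprimeTo)
import Data.Nat.Coprimality as Coprime
open import Data.Bool using (Bool; true; false; if_then_else_)
open import Data.Fin using (Fin; zero; suc; _↑ˡ_; _↑ʳ_)
open import Data.Fin.Properties using (splitAt-↑ˡ; splitAt-↑ʳ)
open import Data.Product using (∃; _,_; proj₁; proj₂)
open import Data.Integer using (+_) renaming (_≤_ to _≤ℤ_)
open import Data.Integer.Properties using (*-identityʳ; drop‿+≤+)
open import Data.Rational using (ℚ; mkℚ; 0ℚ; 1ℚ) renaming (_+_ to _+ℚ_; _≤_ to _≤ℚ_)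
open import Data.Rational.Properties
  using (normalize-coprime; ≤-reflexive; ≤-trans; +-mono-≤; +-identityˡ; drop-*≤*)
open import Function using (_∘_)
open import Relation.Nullary using (¬_)
open import Relation.Binary.PropositionalEquality
  using (_≡_; refl; sym; cong; cong₂; subst; subst₂; module ≡-Reasoning)

ℕtoℚ≡mkℚ : ∀ k → ℕtoℚ k ≡ mkℚ (+ k) 0 (Coprime.sym (1-coprimeTo k))
ℕtoℚ≡mkℚ k = normalize-coprime (Coprime.sym (1-coprimeTo k))

ℕtoℚ-suc : ∀ k → ℕtoℚ (suc k) ≡ 1ℚ +ℚ ℕtoℚ k
ℕtoℚ-suc k rewrite ℕtoℚ≡mkℚ k | *-identityʳ (+ k) = refl

ℕtoℚ-cancel-≤ : ∀ {m k} → ℕtoℚ m ≤ℚ ℕtoℚ k → m ≤ k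
ℕtoℚ-cancel-≤ {m} {k} m≤k =
  drop‿+≤+ (subst₂ _≤ℤ_ (*-identityʳ (+ m)) (*-identityʳ (+ k)) (drop-*≤* m≤k′))
  where
  m≤k′ : mkℚ (+ m) 0 _ ≤ℚ mkℚ (+ k) 0 _
  m≤k′ = subst₂ _≤ℚ_ (ℕtoℚ≡mkℚ m) (ℕtoℚ≡mkℚ k) m≤k

count : ∀ N → (Fin N → Bool) → ℕ
count zero    p = 0
count (suc N) p = (if p zero then 1 else 0) + count N (p ∘ suc)

count-↑ : ∀ l r (p : Fin (l + r) → Bool) →
          count (l + r) p ≡ count l (p ∘ (_↑ˡ r)) + count r (p ∘ (l ↑ʳ_))
count-↑ zero    r p = refl
count-↑ (suc l) r p with p zero
... | true  = cong suc (count-↑ l r (p ∘ suc))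
... | false = count-↑ l r (p ∘ suc)

count-true : ∀ N (p : Fin N → Bool) → (∀ i → p i ≡ true) → count N p ≡ N
count-true zero    p all = refl
count-true (suc N) p all rewrite all zero = cong suc (count-true N (p ∘ suc) (all ∘ suc))

count-false : ∀ N (p : Fin N → Bool) → (∀ i → p i ≡ false) → count N p ≡ 0
count-false zero    p none = refl
count-false (suc N) p none rewrite none zero = count-false N (p ∘ suc) (none ∘ suc)

indicator : Bool → ℚ
indicator b = if b then 1ℚ else 0ℚ

ℕtoℚ-count-suc : ∀ N (p : Fin (suc N) → Bool) →
                 ℕtoℚ (count (suc N) p) ≡ indicator (p zero) +ℚ ℕtoℚ (count N (p ∘ suc))
ℕtoℚ-count-suc N p with p zero
... | true  = ℕtoℚ-suc (count N (p ∘ suc))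
... | false = sym (+-identityˡ (ℕtoℚ (count N (p ∘ suc))))

Σℚ-≤-count : ∀ N (f : Fin N → ℚ) (p : Fin N → Bool) →
             (∀ i → f i ≤ℚ indicator (p i)) → Σℚ N f ≤ℚ ℕtoℚ (count N p)
Σℚ-≤-count zero    f p f≤ = ≤-reflexive refl
Σℚ-≤-count (suc N) f p f≤ =
  ≤-trans (+-mono-≤ (f≤ zero) (Σℚ-≤-count N (f ∘ suc) (p ∘ suc) (f≤ ∘ suc)))
          (≤-reflexive (sym (ℕtoℚ-count-suc N p)))

degree : (G : Graph) → Fin (n G) → ℕ
degree G x = count (n G) (adj G x)

-- The summand of edgeSum is a local function of Defs and cannot be named; it is
-- recovered by unifying Σℚ (n G) f with the unfolded edge sum.
summand : ∀ N (s : ℚ) {f : Fin N → ℚ} → Σℚ N f ≡ s → Fin N → ℚ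
summand N s {f} _ = f

edgeTerm : (G : Graph) → (Fin (n G) → Fin (n G) → ℚ) → Fin (n G) → Fin (n G) → ℚ
edgeTerm G h x = summand (n G) (edgeSum G h x) refl

edgeTerm-≤-indicator : ∀ G h x → (∀ y → adj G x y ≡ true → h x y ≤ℚ 1ℚ) →
                       ∀ y → edgeTerm G h x y ≤ℚ indicator (adj G x y)
edgeTerm-≤-indicator G h x h≤1 y with adj G x y | h≤1 y
... | true  | hxy≤1 = hxy≤1 refl
... | false | _     = ≤-reflexive refl

edgeSum-≤-degree : ∀ G h x → (∀ y → adj G x y ≡ true → h x y ≤ℚ 1ℚ) →
                   edgeSum G h x ≤ℚ ℕtoℚ (degree G x)
edgeSum-≤-degree G h x h≤1 =
  Σℚ-≤-count (n G) (edgeTerm G h x) (adj G x) (edgeTerm-≤-indicator G h x h≤1)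

IsFracFactor⇒≤degree : ∀ G a b h → IsFracFactor G a b h → ∀ x → a ≤ degree G x
IsFracFactor⇒≤degree G a b h (_ , h-bounds , sums) x =
  ℕtoℚ-cancel-≤ (≤-trans (proj₁ (sums x)) (edgeSum-≤-degree G h x h≤1))
  where
  h≤1 : ∀ y → adj G x y ≡ true → h x y ≤ℚ 1ℚ
  h≤1 y xy = proj₂ (h-bounds x y xy)

FracCovered⇒IsFracFactor : ∀ G a b x y → adj G x y ≡ true →
                           FracCovered G a b → ∃ (IsFracFactor G a b)
FracCovered⇒IsFracFactor G a b x y xy covered =
  proj₁ (covered x y xy) , proj₁ (proj₂ (covered x y xy))

module _ (a m : ℕ) where

  private
    rest : ℕ
    rest = 1 + (m ∸ a)

  vertexK₁ : Fin (n (H m a))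
  vertexK₁ = (a ∸ 1) ↑ʳ zero

  vertexK₁-adj-K : ∀ i → adj (H m a) vertexK₁ (i ↑ˡ rest) ≡ true
  vertexK₁-adj-K i rewrite splitAt-↑ʳ (a ∸ 1) rest zero | splitAt-↑ˡ (a ∸ 1) i rest = refl

  vertexK₁-nonadj : ∀ j → adj (H m a) vertexK₁ ((a ∸ 1) ↑ʳ j) ≡ false
  vertexK₁-nonadj j rewrite splitAt-↑ʳ (a ∸ 1) rest zero | splitAt-↑ʳ (a ∸ 1) rest j with j
  ... | zero  = refl
  ... | suc _ = refl

  degree-vertexK₁ : degree (H m a) vertexK₁ ≡ a ∸ 1
  degree-vertexK₁ = begin
    count (a ∸ 1 + rest) row
      ≡⟨ count-↑ (a ∸ 1) rest row ⟩
    count (a ∸ 1) (row ∘ (_↑ˡ rest)) + count rest (row ∘ ((a ∸ 1) ↑ʳ_))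
      ≡⟨ cong₂ _+_ (count-true (a ∸ 1) _ vertexK₁-adj-K) (count-false rest _ vertexK₁-nonadj) ⟩
    a ∸ 1 + 0
      ≡⟨ +-identityʳ (a ∸ 1) ⟩
    a ∸ 1 ∎
    where
    open ≡-Reasoning
    row : Fin (a ∸ 1 + rest) → Bool
    row = adj (H m a) vertexK₁

lemma2p4 : (a b n : ℕ) → 2 ≤ a → a ≤ b → a + 3 ≤ n → ¬ FracCovered (H n a) a b
lemma2p4 a@(suc (suc _)) b n (s≤s (s≤s _)) _ _ covered
  with FracCovered⇒IsFracFactor (H n a) a b (vertexK₁ a n) (zero ↑ˡ (1 + (n ∸ a)))
         (vertexK₁-adj-K a n zero) covered
... | h , factor = 1+n≰n (subst (a ≤_) (degree-vertexK₁ a n) a≤degree)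
  where
  a≤degree : a ≤ degree (H n a) (vertexK₁ a n)
  a≤degree = IsFracFactor⇒≤degree (H n a) a b h factor (vertexK₁ a n)
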